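{- Let $\mathcal{H}'$ be the $K_4^3$-decomposition of a friendship $3$-hypergraph on $n$ vertices. Then \[ |E(\mathcal{H}')| \leq \frac{1}{8} \binom{n}{3} + \frac{1}{12}\binom{n}{2} = \frac{n^2(n-1)}{48}. \]
   Context: For a $3$-uniform hypergraph $\mathcal{H}$ and a set of vertices $A$, a vertex $u \notin A$ is a friend of $A$ in $\mathcal{H}$ if for every $B \subseteq A$ with $|B| = 2$, the set $B \cup \{u\}$ is a hyperedge of $\mathcal{H}$. A $3$-uniform hypergraph is a friendship $3$-hypergraph if every set of $3$ vertices has exactly one friend. The $K_4^3$-decomposition of $\mathcal{H}$ is the $4$-uniform hypergraph $\mathcal{H}'$ on $V(\mathcal{H})$ whose hyperedges are all $4$-subsets of $V(\mathcal{H})$ all of whose $3$-subsets are hyperedges of $\mathcal{H}$. -}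

module Defs where

open import Data.Nat using (ℕ)
open import Data.Bool using (Bool; true; false; _∧_)
open import Data.Fin using (Fin; _<_; _<?_)
open import Data.Fin.Properties using (_≟_)
open import Data.List using (List; allFin; concatMap; filter; length; _∷_; [])
open import Data.Product using (_×_; _,_; ∃-syntax)
open import Relation.Binary.PropositionalEquality using (_≡_; _≢_)
open import Relation.Nullary.Decidable using (does)

-- The value on
-- a triple of pairwise distinct vertices is required to depend only on the
-- underlying 3-set (symmetry); values on triples with repeated vertices are
-- irrelevant (never consulted).
record Hypergraph3 (n : ℕ) : Set where
  field
    edge : Fin n → Fin n → Fin n → Bool
    sym₁ : ∀ a b c → edge a b c ≡ edge b a c
    sym₂ : ∀ a b c → edge a b c ≡ edge a c b

open Hypergraph3 public

IsEdge : ∀ {n} → Hypergraph3 n → Fin n → Fin n → Fin n → Set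
IsEdge H a b c = edge H a b c ≡ true

Friend : ∀ {n} → Hypergraph3 n → Fin n → Fin n → Fin n → Fin n → Set
Friend H a b c u =
  u ≢ a × u ≢ b × u ≢ c ×
  IsEdge H a b u × IsEdge H a c u × IsEdge H b c u

IsFriendship : ∀ {n} → Hypergraph3 n → Set
IsFriendship {n} H =
  ∀ (a b c : Fin n) → a ≢ b → a ≢ c → b ≢ c →
    (∃[ u ] Friend H a b c u) ×
    (∀ u v → Friend H a b c u → Friend H a b c v → u ≡ v)

Quad : ℕ → Set
Quad n = Fin n × Fin n × Fin n × Fin n

increasing : ∀ {n} → Quad n → Bool
increasing (a , b , c , d) = does (a <? b) ∧ does (b <? c) ∧ does (c <? d)

fourSubsets : (n : ℕ) → List (Quad n)
fourSubsets n =
  filter (λ q → increasing q ≟ᵇ true)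
    (concatMap (λ a → concatMap (λ b → concatMap (λ c → concatMap (λ d →
       (a , b , c , d) ∷ []) (allFin n)) (allFin n)) (allFin n)) (allFin n))
  where
  open import Data.Bool.Properties renaming (_≟_ to _≟ᵇ_)

k4edge : ∀ {n} → Hypergraph3 n → Quad n → Bool
k4edge H (a , b , c , d) =
  edge H a b c ∧ edge H a b d ∧ edge H a c d ∧ edge H b c d

k4DecompositionSize : ∀ {n} → Hypergraph3 n → ℕ
k4DecompositionSize {n} H =
  length (filter (λ q → k4edge H q ≟ᵇ true) (fourSubsets n))
  where
  open import Data.Bool.Properties renaming (_≟_ to _≟ᵇ_)

-- Let T be the number of ordered triples spanning a hyperedge (six times |E(H)|), M the same
-- count for non-edges, and S the sum of the squared codegrees over ordered pairs. Fix a hyperedge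
-- pqr and a vertex z. At most one of pqz, prz, qrz is a hyperedge unless z is the friend of pqr
-- (all three are) or exactly two are, and then the remaining vertex of pqr is the friend of the
-- third, a non-edge. Friends being unique, summing over p, q, r, z gives 3S ≤ (n + 2)T + 3M.
-- With T + M = n(n−1)(n−2) and T² ≤ n(n−1)S by Cauchy–Schwarz, T satisfies a quadratic
-- inequality which forces 2T ≤ n²(n−1). Finally a K₄³ is a hyperedge together with its friend,
-- and it is seen in this way from each of its four triples, ordered in 3! ways, so 24|E(H′)| ≤ T.

module Submission where

open import Defs
open import Data.Bool using (Bool; true; false; not; _∧_; _∨_; T)
open import Data.Bool.Properties using (T-∧; T-≡; ∧-comm; ∧-assoc) renaming (_≟_ to _≟ᵇ_)
open import Data.Empty using (⊥; ⊥-elim)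
open import Data.Fin using (Fin; zero; suc; _<_; _<?_; toℕ)
open import Data.Fin.Properties using (_≟_; <-trans; <-asym; <⇒≢; suc-injective)
open import Data.List using (List; []; _∷_; _++_; length; filter; concatMap; tabulate; allFin)
open import Data.List.Properties using (filter-++; length-++; filter-accept; filter-reject)
import Data.Nat as ℕ
open import Data.Nat using (ℕ; zero; suc; _+_; _*_; _∸_; _≤_; _≤?_; _≤ᵇ_; z≤n; s≤s)
open import Data.Nat.Properties
  using ( +-comm; +-identityʳ; *-comm; *-assoc; *-identityˡ; *-identityʳ; *-zeroʳ; *-distribʳ-+
        ; ≤-reflexive; ≤-trans; ≤-total; +-mono-≤; +-monoʳ-≤; +-monoʳ-<; *-mono-≤; *-monoˡ-≤; *-monoʳ-≤
        ; *-cancelˡ-≤; m≤m+n; m≤n⇒∃[o]m+o≡n; m+n∸n≡m; n<1⇒n≡0; ≰⇒>; 1+n≰n; <-irrefl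
        ; ≤ᵇ⇒≤; <ᵇ⇒<; <⇒<ᵇ; +-*-semiring; module ≤-Reasoning)
open import Data.Nat.Solver using (module +-*-Solver)
open import Data.Product using (_×_; _,_; proj₂)
open import Data.Sum using (_⊎_; inj₁; inj₂)
open import Data.Unit using (tt)
open import Data.Vec using (Vec; []; _∷_)
open import Function using (_∘_; case_of_; Equivalence)
open import Relation.Binary.PropositionalEquality
open import Relation.Nullary using (does; yes; no)
open import Relation.Unary using (Decidable)

open import Algebra.Properties.Semiring.Sum +-*-semiring
  using (sum; sum-syntax; sum-cong-≗; ∑-distrib-+; ∑-comm; *-distribˡ-sum; *-distribʳ-sum)
open +-*-Solver using (solve; _:+_; _:*_; _:=_; con)
open Equivalence using (to; from)

-- Booleans as 0/1 values and decision by evaluation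

𝟙 : Bool → ℕ
𝟙 true  = 1
𝟙 false = 0

𝟙≤1 : ∀ b → 𝟙 b ≤ 1
𝟙≤1 true  = s≤s z≤n
𝟙≤1 false = z≤n

𝟙-pos : ∀ {b} → 1 ≤ 𝟙 b → T b
𝟙-pos {true} _ = tt

𝟙-∧-≤ˡ : ∀ a b → 𝟙 (a ∧ b) ≤ 𝟙 a
𝟙-∧-≤ˡ true  b = 𝟙≤1 b
𝟙-∧-≤ˡ false b = z≤n

*-pos : ∀ x y → 1 ≤ x * y → 1 ≤ x × 1 ≤ y
*-pos zero    y       ()
*-pos (suc x) zero    h = ⊥-elim (1+n≰n (subst (1 ≤_) (*-zeroʳ (suc x)) h))
*-pos (suc x) (suc y) h = s≤s z≤n , s≤s z≤n

+-pos : ∀ x y → 1 ≤ x + y → 1 ≤ x ⊎ 1 ≤ y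
+-pos zero    y h = inj₂ h
+-pos (suc x) y h = inj₁ (s≤s z≤n)

∧-elim : ∀ a {b} → T (a ∧ b) → T a × T b
∧-elim true t = tt , t

infixr 1 _⇒ᵇ_
infixl 0 _$ᵇ_

_⇒ᵇ_ : Bool → Bool → Bool
a ⇒ᵇ b = not a ∨ b

⇒ᵇ-intro : ∀ {a b} → (T a → T b) → T (a ⇒ᵇ b)
⇒ᵇ-intro {true}  f = f tt
⇒ᵇ-intro {false} f = tt

_$ᵇ_ : ∀ {a b} → T (a ⇒ᵇ b) → T a → T b
_$ᵇ_ {true} ab _ = ab

not-intro : ∀ {a} → (T a → ⊥) → T (not a)
not-intro {true}  f = f tt
not-intro {false} f = tt

valid : (k : ℕ) → (Vec Bool k → Bool) → Bool
valid zero    φ = φ []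
valid (suc k) φ = valid k (φ ∘ (true ∷_)) ∧ valid k (φ ∘ (false ∷_))

valid-sound : ∀ k φ → T (valid k φ) → ∀ v → T (φ v)
valid-sound zero    φ h []      = h
valid-sound (suc k) φ h (b ∷ v) with ∧-elim (valid k (φ ∘ (true ∷_))) h | b
... | t , _ | true  = valid-sound k (φ ∘ (true ∷_)) t v
... | _ , f | false = valid-sound k (φ ∘ (false ∷_)) f v

-- Finite sums over Fin n

sum-mono-≤ : ∀ {n} {f g : Fin n → ℕ} → (∀ i → f i ≤ g i) → sum f ≤ sum g
sum-mono-≤ {zero}  h = z≤n
sum-mono-≤ {suc n} h = +-mono-≤ (h zero) (sum-mono-≤ (h ∘ suc))

sum-const : ∀ n c → ∑[ i < n ] c ≡ n * c
sum-const zero    c = refl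
sum-const (suc n) c = cong (c +_) (sum-const n c)

sum-zero : ∀ {n} {f : Fin n → ℕ} → (∀ i → f i ≡ 0) → sum f ≡ 0
sum-zero {n} h = trans (sum-cong-≗ h) (trans (sum-const n 0) (*-zeroʳ n))

sum-≤-1 : ∀ {n} {f : Fin n → ℕ} → (∀ i → f i ≤ 1) →
  (∀ i j → 1 ≤ f i → 1 ≤ f j → i ≡ j) → sum f ≤ 1
sum-≤-1 {zero}      f≤1 unique = z≤n
sum-≤-1 {suc n} {f} f≤1 unique with 1 ≤? f zero
... | no  f₀≯0 = subst (λ x → x + sum (f ∘ suc) ≤ 1) (sym (n<1⇒n≡0 (≰⇒> f₀≯0)))
                   (sum-≤-1 (f≤1 ∘ suc) (λ i j p q → suc-injective (unique (suc i) (suc j) p q)))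
... | yes f₀>0 = begin
    f zero + sum (f ∘ suc) ≡⟨ cong (f zero +_) (sum-zero rest-zero) ⟩
    f zero + 0             ≡⟨ +-identityʳ (f zero) ⟩
    f zero                 ≤⟨ f≤1 zero ⟩
    1                      ∎
  where
  open ≤-Reasoning
  rest-zero : ∀ i → f (suc i) ≡ 0
  rest-zero i with 1 ≤? f (suc i)
  ... | yes fᵢ>0 = case unique zero (suc i) f₀>0 fᵢ>0 of λ ()
  ... | no  fᵢ≯0 = n<1⇒n≡0 (≰⇒> fᵢ≯0)

sum-≤-𝟙 : ∀ {n} {f : Fin n → ℕ} (c : Bool) → (∀ i → f i ≤ 1) →
  (∀ i j → 1 ≤ f i → 1 ≤ f j → i ≡ j) → (∀ i → 1 ≤ f i → T c) → sum f ≤ 𝟙 c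
sum-≤-𝟙 true  f≤1 unique support = sum-≤-1 f≤1 unique
sum-≤-𝟙 {f = f} false f≤1 unique support = ≤-reflexive (sum-zero fᵢ≡0)
  where
  fᵢ≡0 : ∀ i → f i ≡ 0
  fᵢ≡0 i with 1 ≤? f i
  ... | yes fᵢ>0 = case support i fᵢ>0 of λ ()
  ... | no  fᵢ≯0 = n<1⇒n≡0 (≰⇒> fᵢ≯0)

2xy≤x²+y²-≤ : ∀ {x y} → x ≤ y → 2 * (x * y) ≤ x * x + y * y
2xy≤x²+y²-≤ {x} x≤y with m≤n⇒∃[o]m+o≡n x≤y
... | d , refl = subst (2 * (x * (x + d)) ≤_)
  (solve 2 (λ x d → con 2 :* (x :* (x :+ d)) :+ d :* d := x :* x :+ (x :+ d) :* (x :+ d)) refl x d)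
  (m≤m+n _ (d * d))

2xy≤x²+y² : ∀ x y → 2 * (x * y) ≤ x * x + y * y
2xy≤x²+y² x y with ≤-total x y
... | inj₁ x≤y = 2xy≤x²+y²-≤ x≤y
... | inj₂ y≤x = subst₂ (λ u v → 2 * u ≤ v) (*-comm y x) (+-comm (y * y) (x * x)) (2xy≤x²+y²-≤ y≤x)

sum-*-sum : ∀ {n} (f g : Fin n → ℕ) → sum f * sum g ≡ sum (λ i → sum (λ j → f i * g j))
sum-*-sum f g = trans (*-distribʳ-sum (sum g) f) (sum-cong-≗ (λ i → *-distribˡ-sum (f i) g))

cauchy-schwarz : ∀ {n} (a b : Fin n → ℕ) →
  sum (λ i → a i * b i) * sum (λ i → a i * b i) ≤ sum (λ i → a i * a i) * sum (λ i → b i * b i)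
cauchy-schwarz {n} a b = *-cancelˡ-≤ 2 (begin
  2 * (X * X)
    ≡⟨ cong (2 *_) (sum-*-sum ab ab) ⟩
  2 * sum (λ i → sum (λ j → ab i * ab j))
    ≡⟨ trans (*-distribˡ-sum 2 (λ i → sum (λ j → ab i * ab j))) (sum-cong-≗ (λ i → *-distribˡ-sum 2 (λ j → ab i * ab j))) ⟩
  sum (λ i → sum (λ j → 2 * (ab i * ab j)))
    ≤⟨ sum-mono-≤ (λ i → sum-mono-≤ (λ j → lagrange i j)) ⟩
  sum (λ i → sum (λ j → aa i * bb j + bb i * aa j))
    ≡⟨ trans (sum-cong-≗ (λ i → ∑-distrib-+ (λ j → aa i * bb j) (λ j → bb i * aa j)))
             (∑-distrib-+ (λ i → sum (λ j → aa i * bb j)) (λ i → sum (λ j → bb i * aa j))) ⟩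
  sum (λ i → sum (λ j → aa i * bb j)) + sum (λ i → sum (λ j → bb i * aa j))
    ≡⟨ cong₂ _+_ (sum-*-sum aa bb) (sum-*-sum bb aa) ⟨
  A * B + B * A
    ≡⟨ solve 2 (λ A B → A :* B :+ B :* A := con 2 :* (A :* B)) refl A B ⟩
  2 * (A * B) ∎)
  where
  open ≤-Reasoning
  ab aa bb : Fin n → ℕ
  ab i = a i * b i
  aa i = a i * a i
  bb i = b i * b i
  X A B : ℕ
  X = sum ab
  A = sum aa
  B = sum bb
  lagrange : ∀ i j → 2 * (ab i * ab j) ≤ aa i * bb j + bb i * aa j
  lagrange i j = subst₂ (λ u v → 2 * u ≤ v)
    (solve 4 (λ ai bi aj bj → (ai :* bj) :* (aj :* bi) := (ai :* bi) :* (aj :* bj)) refl (a i) (b i) (a j) (b j))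
    (solve 4 (λ ai bi aj bj → (ai :* bj) :* (ai :* bj) :+ (aj :* bi) :* (aj :* bi)
                           := (ai :* ai) :* (bj :* bj) :+ (bi :* bi) :* (aj :* aj)) refl (a i) (b i) (a j) (b j))
    (2xy≤x²+y² (a i * b j) (a j * b i))

cauchy-schwarz-1 : ∀ {n} (f : Fin n → ℕ) → sum f * sum f ≤ n * sum (λ i → f i * f i)
cauchy-schwarz-1 {n} f = subst₂ _≤_
  (cong₂ _*_ 1*f≡f 1*f≡f)
  (cong (_* sum (λ i → f i * f i)) (trans (sum-const n 1) (*-identityʳ n)))
  (cauchy-schwarz (λ _ → 1) f)
  where
  1*f≡f : sum (λ i → 1 * f i) ≡ sum f
  1*f≡f = sum-cong-≗ (λ i → *-identityˡ (f i))

∑³ : ∀ {n} → (Fin n → Fin n → Fin n → ℕ) → ℕ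
∑³ f = sum (λ a → sum (λ b → sum (f a b)))

∑⁴ : ∀ {n} → (Fin n → Fin n → Fin n → Fin n → ℕ) → ℕ
∑⁴ f = ∑³ (λ a b c → sum (f a b c))

module _ {n : ℕ} where

  ∑³-cong : {f g : Fin n → Fin n → Fin n → ℕ} → (∀ a b c → f a b c ≡ g a b c) → ∑³ f ≡ ∑³ g
  ∑³-cong h = sum-cong-≗ (λ a → sum-cong-≗ (λ b → sum-cong-≗ (h a b)))

  ∑³-mono-≤ : {f g : Fin n → Fin n → Fin n → ℕ} → (∀ a b c → f a b c ≤ g a b c) → ∑³ f ≤ ∑³ g
  ∑³-mono-≤ h = sum-mono-≤ (λ a → sum-mono-≤ (λ b → sum-mono-≤ (h a b)))

  ∑³-distrib-+ : (f g : Fin n → Fin n → Fin n → ℕ) →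
    ∑³ (λ a b c → f a b c + g a b c) ≡ ∑³ f + ∑³ g
  ∑³-distrib-+ f g = begin
    ∑³ (λ a b c → f a b c + g a b c)
      ≡⟨ sum-cong-≗ (λ a → sum-cong-≗ (λ b → ∑-distrib-+ (f a b) (g a b))) ⟩
    sum (λ a → sum (λ b → sum (f a b) + sum (g a b)))
      ≡⟨ sum-cong-≗ (λ a → ∑-distrib-+ (λ b → sum (f a b)) (λ b → sum (g a b))) ⟩
    sum (λ a → sum (λ b → sum (f a b)) + sum (λ b → sum (g a b)))
      ≡⟨ ∑-distrib-+ (λ a → sum (λ b → sum (f a b))) (λ a → sum (λ b → sum (g a b))) ⟩
    ∑³ f + ∑³ g ∎
    where open ≡-Reasoning

  ∑³-*ˡ : (k : ℕ) (f : Fin n → Fin n → Fin n → ℕ) → ∑³ (λ a b c → k * f a b c) ≡ k * ∑³ f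
  ∑³-*ˡ k f = sym (begin
    k * ∑³ f
      ≡⟨ *-distribˡ-sum k (λ a → sum (λ b → sum (f a b))) ⟩
    sum (λ a → k * sum (λ b → sum (f a b)))
      ≡⟨ sum-cong-≗ (λ a → *-distribˡ-sum k (λ b → sum (f a b))) ⟩
    sum (λ a → sum (λ b → k * sum (f a b)))
      ≡⟨ sum-cong-≗ (λ a → sum-cong-≗ (λ b → *-distribˡ-sum k (f a b))) ⟩
    ∑³ (λ a b c → k * f a b c) ∎)
    where open ≡-Reasoning

  ∑³-swap₁₂ : (f : Fin n → Fin n → Fin n → ℕ) → ∑³ f ≡ ∑³ (λ a b c → f b a c)
  ∑³-swap₁₂ f = ∑-comm (λ a b → sum (f a b))

  ∑³-swap₂₃ : (f : Fin n → Fin n → Fin n → ℕ) → ∑³ f ≡ ∑³ (λ a b c → f a c b)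
  ∑³-swap₂₃ f = sum-cong-≗ (λ a → ∑-comm (f a))

  ∑⁴-mono-≤ : {f g : Fin n → Fin n → Fin n → Fin n → ℕ} → (∀ a b c d → f a b c d ≤ g a b c d) → ∑⁴ f ≤ ∑⁴ g
  ∑⁴-mono-≤ h = ∑³-mono-≤ (λ a b c → sum-mono-≤ (h a b c))

  ∑⁴-distrib-+ : (f g : Fin n → Fin n → Fin n → Fin n → ℕ) →
    ∑⁴ (λ a b c d → f a b c d + g a b c d) ≡ ∑⁴ f + ∑⁴ g
  ∑⁴-distrib-+ f g = trans (∑³-cong (λ a b c → ∑-distrib-+ (f a b c) (g a b c)))
                           (∑³-distrib-+ (λ a b c → sum (f a b c)) (λ a b c → sum (g a b c)))

  ∑⁴-swap₁₂ : (f : Fin n → Fin n → Fin n → Fin n → ℕ) → ∑⁴ f ≡ ∑⁴ (λ a b c d → f b a c d)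
  ∑⁴-swap₁₂ f = ∑³-swap₁₂ (λ a b c → sum (f a b c))

  ∑⁴-swap₂₃ : (f : Fin n → Fin n → Fin n → Fin n → ℕ) → ∑⁴ f ≡ ∑⁴ (λ a b c d → f a c b d)
  ∑⁴-swap₂₃ f = ∑³-swap₂₃ (λ a b c → sum (f a b c))

  ∑⁴-swap₃₄ : (f : Fin n → Fin n → Fin n → Fin n → ℕ) → ∑⁴ f ≡ ∑⁴ (λ a b c d → f a b d c)
  ∑⁴-swap₃₄ f = sum-cong-≗ (λ a → sum-cong-≗ (λ b → ∑-comm (f a b)))

module _ {A : Set} (count : List A → ℕ) (count-[] : count [] ≡ 0)
         (count-++ : ∀ xs ys → count (xs ++ ys) ≡ count xs + count ys) where

  count-concatMap : ∀ {m} {B : Set} (f : B → List A) (g : Fin m → B) →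
    count (concatMap f (tabulate g)) ≡ sum (λ i → count (f (g i)))
  count-concatMap {zero}  f g = count-[]
  count-concatMap {suc m} f g =
    trans (count-++ (f (g zero)) (concatMap f (tabulate (g ∘ suc))))
          (cong (count (f (g zero)) +_) (count-concatMap f (g ∘ suc)))

filter-filter-singleton : ∀ {A : Set} (f g : A → Bool) x →
  length (filter (λ y → f y ≟ᵇ true) (filter (λ y → g y ≟ᵇ true) (x ∷ []))) ≡ 𝟙 (g x ∧ f x)
filter-filter-singleton f g x = go (g x) refl (f x) refl
  where
  f? : Decidable (λ y → f y ≡ true)
  f? y = f y ≟ᵇ true
  g? : Decidable (λ y → g y ≡ true)
  g? y = g y ≟ᵇ true
  go : ∀ b → g x ≡ b → ∀ c → f x ≡ c → length (filter f? (filter g? (x ∷ []))) ≡ 𝟙 (b ∧ c)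
  go true  gx true  fx = cong length (trans (cong (filter f?) (filter-accept g? gx)) (filter-accept f? fx))
  go true  gx false fx = cong length (trans (cong (filter f?) (filter-accept g? gx)) (filter-reject f? ((λ ()) ∘ trans (sym fx))))
  go false gx c     fx = cong (length ∘ filter f?) (filter-reject g? ((λ ()) ∘ trans (sym gx)))

_≠ᵇ_ : ∀ {n} → Fin n → Fin n → Bool
a ≠ᵇ b = not (does (a ≟ b))

≠ᵇ-sound : ∀ {n} {a b : Fin n} → T (a ≠ᵇ b) → a ≢ b
≠ᵇ-sound {a = a} {b} a≠b with a ≟ b
≠ᵇ-sound () | yes _
... | no a≢b = a≢b

≠ᵇ-complete : ∀ {n} {a b : Fin n} → a ≢ b → T (a ≠ᵇ b)
≠ᵇ-complete {a = a} {b} a≢b with a ≟ b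
... | yes a≡b = a≢b a≡b
... | no  _   = tt

≠ᵇ-sym : ∀ {n} (a b : Fin n) → a ≠ᵇ b ≡ b ≠ᵇ a
≠ᵇ-sym a b with a ≟ b | b ≟ a
... | yes _   | yes _   = refl
... | no  _   | no  _   = refl
... | yes a≡b | no  b≢a = ⊥-elim (b≢a (sym a≡b))
... | no  a≢b | yes b≡a = ⊥-elim (a≢b (sym b≡a))

sum-𝟙-≡ : ∀ {n} (p : Fin n) → ∑[ r < n ] 𝟙 (does (p ≟ r)) ≡ 1
sum-𝟙-≡ {suc n} zero    = cong suc (sum-zero {n} (λ _ → refl))
sum-𝟙-≡ {suc n} (suc p) = sum-𝟙-≡ p

+-≡⇒≡∸ : ∀ {x k m} → x + k ≡ m → x ≡ m ∸ k
+-≡⇒≡∸ {x} {k} refl = sym (m+n∸n≡m x k)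

sum-𝟙-≠ : ∀ {n} (p : Fin n) → ∑[ r < n ] 𝟙 (p ≠ᵇ r) ≡ n ∸ 1
sum-𝟙-≠ {n} p = +-≡⇒≡∸ (begin
  ∑[ r < n ] 𝟙 (p ≠ᵇ r) + 1
    ≡⟨ cong (∑[ r < n ] 𝟙 (p ≠ᵇ r) +_) (sum-𝟙-≡ p) ⟨
  ∑[ r < n ] 𝟙 (p ≠ᵇ r) + ∑[ r < n ] 𝟙 (does (p ≟ r))
    ≡⟨ ∑-distrib-+ (λ r → 𝟙 (p ≠ᵇ r)) (λ r → 𝟙 (does (p ≟ r))) ⟨
  ∑[ r < n ] (𝟙 (p ≠ᵇ r) + 𝟙 (does (p ≟ r)))
    ≡⟨ sum-cong-≗ (λ r → 𝟙-not+𝟙 (does (p ≟ r))) ⟩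
  ∑[ r < n ] 1
    ≡⟨ trans (sum-const n 1) (*-identityʳ n) ⟩
  n ∎)
  where
  open ≡-Reasoning
  𝟙-not+𝟙 : ∀ b → 𝟙 (not b) + 𝟙 b ≡ 1
  𝟙-not+𝟙 true  = refl
  𝟙-not+𝟙 false = refl

sum-𝟙-≠≠ : ∀ {n} {p q : Fin n} → p ≢ q → ∑[ r < n ] 𝟙 (p ≠ᵇ r ∧ q ≠ᵇ r) ≡ n ∸ 2
sum-𝟙-≠≠ {n} {p} {q} p≢q = +-≡⇒≡∸ (begin
  ∑[ r < n ] 𝟙 (p ≠ᵇ r ∧ q ≠ᵇ r) + 2
    ≡⟨ cong (∑[ r < n ] 𝟙 (p ≠ᵇ r ∧ q ≠ᵇ r) +_) (cong₂ _+_ (sum-𝟙-≡ p) (sum-𝟙-≡ q)) ⟨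
  ∑[ r < n ] 𝟙 (p ≠ᵇ r ∧ q ≠ᵇ r) + (∑[ r < n ] 𝟙 (does (p ≟ r)) + ∑[ r < n ] 𝟙 (does (q ≟ r)))
    ≡⟨ cong (∑[ r < n ] 𝟙 (p ≠ᵇ r ∧ q ≠ᵇ r) +_)
            (∑-distrib-+ (λ r → 𝟙 (does (p ≟ r))) (λ r → 𝟙 (does (q ≟ r)))) ⟨
  ∑[ r < n ] 𝟙 (p ≠ᵇ r ∧ q ≠ᵇ r) + ∑[ r < n ] (𝟙 (does (p ≟ r)) + 𝟙 (does (q ≟ r)))
    ≡⟨ ∑-distrib-+ (λ r → 𝟙 (p ≠ᵇ r ∧ q ≠ᵇ r)) (λ r → 𝟙 (does (p ≟ r)) + 𝟙 (does (q ≟ r))) ⟨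
  ∑[ r < n ] (𝟙 (p ≠ᵇ r ∧ q ≠ᵇ r) + (𝟙 (does (p ≟ r)) + 𝟙 (does (q ≟ r))))
    ≡⟨ sum-cong-≗ partition ⟩
  ∑[ r < n ] 1
    ≡⟨ trans (sum-const n 1) (*-identityʳ n) ⟩
  n ∎)
  where
  open ≡-Reasoning
  partition : ∀ r → 𝟙 (p ≠ᵇ r ∧ q ≠ᵇ r) + (𝟙 (does (p ≟ r)) + 𝟙 (does (q ≟ r))) ≡ 1
  partition r with p ≟ r | q ≟ r
  ... | yes refl | yes refl = ⊥-elim (p≢q refl)
  ... | yes _    | no  _    = refl
  ... | no  _    | yes _    = refl
  ... | no  _    | no  _    = refl

distinct : ∀ {n} → Fin n → Fin n → Fin n → Bool
distinct p q r = p ≠ᵇ q ∧ p ≠ᵇ r ∧ q ≠ᵇ r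

∑³-distinct : ∀ n → ∑³ {n} (λ p q r → 𝟙 (distinct p q r)) ≡ n * ((n ∸ 1) * (n ∸ 2))
∑³-distinct n = begin
  ∑³ {n} (λ p q r → 𝟙 (distinct p q r))
    ≡⟨ sum-cong-≗ (λ p → sum-cong-≗ (third p)) ⟩
  ∑[ p < n ] ∑[ q < n ] (𝟙 (p ≠ᵇ q) * (n ∸ 2))
    ≡⟨ sum-cong-≗ {n} (λ p → trans (sym (*-distribʳ-sum (n ∸ 2) (λ q → 𝟙 (p ≠ᵇ q))))
                                   (cong (_* (n ∸ 2)) (sum-𝟙-≠ p))) ⟩
  ∑[ p < n ] ((n ∸ 1) * (n ∸ 2))
    ≡⟨ sum-const n _ ⟩
  n * ((n ∸ 1) * (n ∸ 2)) ∎
  where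
  open ≡-Reasoning
  third : ∀ p q → ∑[ r < n ] 𝟙 (distinct p q r) ≡ 𝟙 (p ≠ᵇ q) * (n ∸ 2)
  third p q with p ≟ q
  ... | yes _   = sum-zero {n} (λ _ → refl)
  ... | no  p≢q = trans (sum-𝟙-≠≠ p≢q) (sym (+-identityʳ (n ∸ 2)))

_<ᵇ_ : ∀ {n} → Fin n → Fin n → Bool
a <ᵇ b = does (a <? b)

<ᵇ-sound : ∀ {n} {a b : Fin n} → T (a <ᵇ b) → a < b
<ᵇ-sound {a = a} {b} = <ᵇ⇒< (toℕ a) (toℕ b)

<ᵇ-complete : ∀ {n} {a b : Fin n} → a < b → T (a <ᵇ b)
<ᵇ-complete = <⇒<ᵇ

<ᵇ⇒≠ᵇ : ∀ {n} (a b : Fin n) → T (a <ᵇ b ⇒ᵇ a ≠ᵇ b)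
<ᵇ⇒≠ᵇ a b = ⇒ᵇ-intro λ a<b → ≠ᵇ-complete (<⇒≢ (<ᵇ-sound {a = a} a<b))

<ᵇ-asym : ∀ {n} (a b : Fin n) → T (not (a <ᵇ b ∧ b <ᵇ a))
<ᵇ-asym a b = not-intro λ t →
  let (a<b , b<a) = ∧-elim (a <ᵇ b) t in <-asym (<ᵇ-sound {a = a} a<b) (<ᵇ-sound {a = b} b<a)

<ᵇ-trans : ∀ {n} (a b c : Fin n) → T (a <ᵇ b ∧ b <ᵇ c ⇒ᵇ a <ᵇ c)
<ᵇ-trans a b c = ⇒ᵇ-intro λ t →
  let (a<b , b<c) = ∧-elim (a <ᵇ b) t in <ᵇ-complete {a = a} {c} (<-trans (<ᵇ-sound {a = a} a<b) (<ᵇ-sound {a = b} b<c))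

module HypergraphCounts {n : ℕ} (H : Hypergraph3 n) where

  χ χ̄ : Fin n → Fin n → Fin n → ℕ
  χ  p q r = 𝟙 (distinct p q r ∧ edge H p q r)
  χ̄ p q r = 𝟙 (distinct p q r ∧ not (edge H p q r))

  χ≤1 : ∀ p q r → χ p q r ≤ 1
  χ≤1 p q r = 𝟙≤1 _

  χ-swap₁₂ : ∀ p q r → χ p q r ≡ χ q p r
  χ-swap₁₂ p q r = cong 𝟙 (cong₂ _∧_ distinct-swap (sym₁ H p q r))
    where
    distinct-swap : distinct p q r ≡ distinct q p r
    distinct-swap = cong₂ _∧_ (≠ᵇ-sym p q) (∧-comm (p ≠ᵇ r) (q ≠ᵇ r))

  χ-swap₂₃ : ∀ p q r → χ p q r ≡ χ p r q
  χ-swap₂₃ p q r = cong 𝟙 (cong₂ _∧_ distinct-swap (sym₂ H p q r))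
    where
    distinct-swap : distinct p q r ≡ distinct p r q
    distinct-swap = trans (∧-swapˡ (p ≠ᵇ q) (p ≠ᵇ r) (q ≠ᵇ r)) (cong (λ b → p ≠ᵇ r ∧ p ≠ᵇ q ∧ b) (≠ᵇ-sym q r))
      where
      ∧-swapˡ : ∀ x y z → x ∧ y ∧ z ≡ y ∧ x ∧ z
      ∧-swapˡ x y z = trans (sym (∧-assoc x y z)) (trans (cong (_∧ z) (∧-comm x y)) (∧-assoc y x z))

  χ-pos : ∀ {p q r} → 1 ≤ χ p q r → p ≢ q × p ≢ r × q ≢ r × IsEdge H p q r
  χ-pos {p} {q} {r} h with ∧-elim (distinct p q r) (𝟙-pos h)
  ... | d , e with ∧-elim (p ≠ᵇ q) d
  ... | pq , d′ with ∧-elim (p ≠ᵇ r) d′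
  ... | pr , qr = ≠ᵇ-sound pq , ≠ᵇ-sound pr , ≠ᵇ-sound qr , T-≡ .to e

  friendᵢ : Fin n → Fin n → Fin n → Fin n → ℕ
  friendᵢ p q r z = χ p q z * (χ p r z * χ q r z)

  friendᵢ-pos : ∀ {p q r z} → 1 ≤ friendᵢ p q r z → p ≢ q × p ≢ r × q ≢ r × Friend H p q r z
  friendᵢ-pos {p} {q} {r} {z} h =
    let (h₁ , h₂₃) = *-pos (χ p q z) _ h
        (h₂ , h₃)  = *-pos (χ p r z) _ h₂₃
        (pq , pz , qz , pqz) = χ-pos h₁
        (pr , _  , rz , prz) = χ-pos h₂
        (qr , _  , _  , qrz) = χ-pos h₃
    in pq , pr , qr , ≢-sym pz , ≢-sym qz , ≢-sym rz , pqz , prz , qrz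

  edgeSum nonEdgeSum : ℕ
  edgeSum    = ∑³ χ
  nonEdgeSum = ∑³ χ̄

  codegree : Fin n → Fin n → ℕ
  codegree p q = sum (χ p q)

  codegreeSquareSum : ℕ
  codegreeSquareSum = sum (λ p → sum (λ q → codegree p q * codegree p q))

  edgeSum+nonEdgeSum : edgeSum + nonEdgeSum ≡ n * ((n ∸ 1) * (n ∸ 2))
  edgeSum+nonEdgeSum = begin
    ∑³ χ + ∑³ χ̄                            ≡⟨ ∑³-distrib-+ χ χ̄ ⟨
    ∑³ (λ p q r → χ p q r + χ̄ p q r)       ≡⟨ ∑³-cong (λ p q r → 𝟙-split (distinct p q r) (edge H p q r)) ⟩
    ∑³ {n} (λ p q r → 𝟙 (distinct p q r)) ≡⟨ ∑³-distinct n ⟩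
    n * ((n ∸ 1) * (n ∸ 2))                ∎
    where
    open ≡-Reasoning
    𝟙-split : ∀ d e → 𝟙 (d ∧ e) + 𝟙 (d ∧ not e) ≡ 𝟙 d
    𝟙-split false e     = refl
    𝟙-split true  true  = refl
    𝟙-split true  false = refl

  𝟙≠ᵇ*codegree : ∀ p q → 𝟙 (p ≠ᵇ q) * codegree p q ≡ codegree p q
  𝟙≠ᵇ*codegree p q with p ≟ q
  ... | yes refl = sym (sum-zero {n} (λ _ → refl))
  ... | no  _    = +-identityʳ _

  edgeSum²-bound : edgeSum * edgeSum ≤ n * (n ∸ 1) * codegreeSquareSum
  edgeSum²-bound = begin
    sum degree * sum degree
      ≤⟨ cauchy-schwarz-1 degree ⟩
    n * sum (λ p → degree p * degree p)
      ≤⟨ *-monoʳ-≤ n (sum-mono-≤ degree²-bound) ⟩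
    n * sum (λ p → (n ∸ 1) * sum (λ q → codegree p q * codegree p q))
      ≡⟨ cong (n *_) (*-distribˡ-sum (n ∸ 1) (λ p → sum (λ q → codegree p q * codegree p q))) ⟨
    n * ((n ∸ 1) * codegreeSquareSum)
      ≡⟨ *-assoc n (n ∸ 1) codegreeSquareSum ⟨
    n * (n ∸ 1) * codegreeSquareSum ∎
    where
    open ≤-Reasoning
    degree : Fin n → ℕ
    degree p = sum (codegree p)
    -- Weighting by p ≠ q is free, as codegree p p = 0, and improves the factor n to n − 1.
    degree²-bound : ∀ p → degree p * degree p ≤ (n ∸ 1) * sum (λ q → codegree p q * codegree p q)
    degree²-bound p = subst₂ _≤_
      (cong₂ _*_ weighted≡degree weighted≡degree)
      (cong (_* sum (λ q → codegree p q * codegree p q)) (trans (sum-cong-≗ (λ q → 𝟙²≡𝟙 (p ≠ᵇ q))) (sum-𝟙-≠ p)))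
      (cauchy-schwarz (λ q → 𝟙 (p ≠ᵇ q)) (codegree p))
      where
      weighted≡degree : sum (λ q → 𝟙 (p ≠ᵇ q) * codegree p q) ≡ degree p
      weighted≡degree = sum-cong-≗ (𝟙≠ᵇ*codegree p)
      𝟙²≡𝟙 : ∀ b → 𝟙 b * 𝟙 b ≡ 𝟙 b
      𝟙²≡𝟙 true  = refl
      𝟙²≡𝟙 false = refl

module FriendshipBounds {n : ℕ} (H : Hypergraph3 n) (friendship : IsFriendship H) where

  open HypergraphCounts H

  friendᵢ-sum≤1 : ∀ p q r → sum (friendᵢ p q r) ≤ 1
  friendᵢ-sum≤1 p q r = sum-≤-1 friendᵢ≤1 unique
    where
    friendᵢ≤1 : ∀ z → friendᵢ p q r z ≤ 1
    friendᵢ≤1 z = *-mono-≤ (χ≤1 p q z) (*-mono-≤ (χ≤1 p r z) (χ≤1 q r z))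
    unique : ∀ u v → 1 ≤ friendᵢ p q r u → 1 ≤ friendᵢ p q r v → u ≡ v
    unique u v hu hv =
      let (pq , pr , qr , friend-u) = friendᵢ-pos hu
          (_  , _  , _  , friend-v) = friendᵢ-pos hv
      in proj₂ (friendship p q r pq pr qr) u v friend-u friend-v

  ∑⁴-weighted-friends : (w : Fin n → Fin n → Fin n → ℕ) →
    ∑⁴ (λ p q r z → w p q r * friendᵢ p q r z) ≤ ∑³ w
  ∑⁴-weighted-friends w = ∑³-mono-≤ λ p q r → begin
    sum (λ z → w p q r * friendᵢ p q r z) ≡⟨ *-distribˡ-sum (w p q r) (friendᵢ p q r) ⟨
    w p q r * sum (friendᵢ p q r)         ≤⟨ *-monoʳ-≤ (w p q r) (friendᵢ-sum≤1 p q r) ⟩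
    w p q r * 1                           ≡⟨ *-identityʳ (w p q r) ⟩
    w p q r                               ∎
    where open ≤-Reasoning

  codegree-inequality : Vec Bool 10 → Bool
  codegree-inequality (dpq ∷ dpr ∷ dqr ∷ dpz ∷ dqz ∷ drz ∷ epqr ∷ epqz ∷ eprz ∷ eqrz ∷ []) =
    χpqr * (χpqz + χprz + χqrz) ≤ᵇ
      χpqr + 2 * (χpqr * (χpqz * (χprz * χqrz)))
      + χ̄pqz * (χpqr * (χprz * χqrz)) + χ̄prz * (χpqr * (χpqz * χqrz)) + χ̄qrz * (χpqr * (χpqz * χprz))
    where
    χpqr = 𝟙 ((dpq ∧ dpr ∧ dqr) ∧ epqr)
    χpqz = 𝟙 ((dpq ∧ dpz ∧ dqz) ∧ epqz)
    χprz = 𝟙 ((dpr ∧ dpz ∧ drz) ∧ eprz)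
    χqrz = 𝟙 ((dqr ∧ dqz ∧ drz) ∧ eqrz)
    χ̄pqz = 𝟙 ((dpq ∧ dpz ∧ dqz) ∧ not epqz)
    χ̄prz = 𝟙 ((dpr ∧ dpz ∧ drz) ∧ not eprz)
    χ̄qrz = 𝟙 ((dqr ∧ dqz ∧ drz) ∧ not eqrz)

  -- If exactly two of pqz, prz, qrz are hyperedges, the third is a non-edge on three distinct
  -- vertices and the remaining vertex of pqr is its friend.
  codegree-pointwise : ∀ p q r z →
    χ p q r * (χ p q z + χ p r z + χ q r z) ≤
      χ p q r + 2 * (χ p q r * friendᵢ p q r z)
      + χ̄ p q z * friendᵢ p q z r + χ̄ p r z * friendᵢ p r z q + χ̄ q r z * friendᵢ q r z p
  codegree-pointwise p q r z = ≤-trans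
    (≤ᵇ⇒≤ _ _ (valid-sound 10 codegree-inequality tt
      (p ≠ᵇ q ∷ p ≠ᵇ r ∷ q ≠ᵇ r ∷ p ≠ᵇ z ∷ q ≠ᵇ z ∷ r ≠ᵇ z ∷
       edge H p q r ∷ edge H p q z ∷ edge H p r z ∷ edge H q r z ∷ [])))
    (≤-reflexive (cong₂ _+_ (cong₂ _+_ (cong (λ x → χ p q r + 2 * (χ p q r * friendᵢ p q r z) + χ̄ p q z * x) pqzr)
                                       (cong (χ̄ p r z *_) przq))
                            (cong (χ̄ q r z *_) qrzp)))
    where
    pqzr : χ p q r * (χ p r z * χ q r z) ≡ friendᵢ p q z r
    pqzr = cong₂ (λ x y → χ p q r * (x * y)) (χ-swap₂₃ p r z) (χ-swap₂₃ q r z)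
    przq : χ p q r * (χ p q z * χ q r z) ≡ friendᵢ p r z q
    przq = cong₂ _*_ (χ-swap₂₃ p q r) (cong₂ _*_ (χ-swap₂₃ p q z) (trans (χ-swap₁₂ q r z) (χ-swap₂₃ r q z)))
    qrzp : χ p q r * (χ p q z * χ p r z) ≡ friendᵢ q r z p
    qrzp = cong₂ _*_ (trans (χ-swap₁₂ p q r) (χ-swap₂₃ q p r))
             (cong₂ _*_ (trans (χ-swap₁₂ p q z) (χ-swap₂₃ q p z)) (trans (χ-swap₁₂ p r z) (χ-swap₂₃ r p z)))

  ∑⁴-codegree-side : ∑⁴ (λ p q r z → χ p q r * (χ p q z + χ p r z + χ q r z)) ≡ 3 * codegreeSquareSum
  ∑⁴-codegree-side = begin
    ∑⁴ (λ p q r z → χ p q r * (χ p q z + χ p r z + χ q r z))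
      ≡⟨ ∑³-cong (λ p q r → sum-cong-≗ (λ z → distribute p q r z)) ⟩
    ∑⁴ (λ p q r z → χ p q r * χ p q z + χ p q r * χ p r z + χ p q r * χ q r z)
      ≡⟨ trans (∑⁴-distrib-+ _ (λ p q r z → χ p q r * χ q r z))
               (cong (_+ ∑⁴ (λ p q r z → χ p q r * χ q r z))
                     (∑⁴-distrib-+ (λ p q r z → χ p q r * χ p q z) (λ p q r z → χ p q r * χ p r z))) ⟩
    ∑⁴ (λ p q r z → χ p q r * χ p q z) + ∑⁴ (λ p q r z → χ p q r * χ p r z) + ∑⁴ (λ p q r z → χ p q r * χ q r z)
      ≡⟨ cong₂ _+_ (cong₂ _+_ (edge-then-codegree) (via-swap₂₃)) via-swap₁₂₃ ⟩
    codegreeSquareSum + codegreeSquareSum + codegreeSquareSum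
      ≡⟨ solve 1 (λ S → S :+ S :+ S := con 3 :* S) refl codegreeSquareSum ⟩
    3 * codegreeSquareSum ∎
    where
    open ≡-Reasoning
    distribute : ∀ p q r z → χ p q r * (χ p q z + χ p r z + χ q r z)
                           ≡ χ p q r * χ p q z + χ p q r * χ p r z + χ p q r * χ q r z
    distribute p q r z = solve 4 (λ a b c d → a :* (b :+ c :+ d) := a :* b :+ a :* c :+ a :* d) refl
                                 (χ p q r) (χ p q z) (χ p r z) (χ q r z)
    edge-then-codegree : ∑⁴ (λ p q r z → χ p q r * χ p q z) ≡ codegreeSquareSum
    edge-then-codegree = sum-cong-≗ λ p → sum-cong-≗ λ q →
      trans (sum-cong-≗ (λ r → sym (*-distribˡ-sum (χ p q r) (χ p q)))) (sym (*-distribʳ-sum (codegree p q) (χ p q)))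
    via-swap₂₃ : ∑⁴ (λ p q r z → χ p q r * χ p r z) ≡ codegreeSquareSum
    via-swap₂₃ = trans (∑⁴-swap₂₃ (λ p q r z → χ p q r * χ p r z))
                       (trans (∑³-cong (λ p q r → sum-cong-≗ (λ z → cong (_* χ p q z) (χ-swap₂₃ p r q))))
                              edge-then-codegree)
    via-swap₁₂₃ : ∑⁴ (λ p q r z → χ p q r * χ q r z) ≡ codegreeSquareSum
    via-swap₁₂₃ = trans (∑⁴-swap₁₂ (λ p q r z → χ p q r * χ q r z))
                 (trans (∑⁴-swap₂₃ (λ p q r z → χ q p r * χ p r z))
                 (trans (∑³-cong (λ p q r → sum-cong-≗ (λ z →
                          cong (_* χ p q z) (trans (χ-swap₁₂ r p q) (χ-swap₂₃ p r q)))))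
                        edge-then-codegree))

  ∑⁴-friend-side : ∑⁴ (λ p q r z → χ p q r + 2 * (χ p q r * friendᵢ p q r z)
      + χ̄ p q z * friendᵢ p q z r + χ̄ p r z * friendᵢ p r z q + χ̄ q r z * friendᵢ q r z p)
    ≤ (n + 2) * edgeSum + 3 * nonEdgeSum
  ∑⁴-friend-side = begin
    ∑⁴ (λ p q r z → A p q r z + B p q r z + C₁ p q r z + C₂ p q r z + C₃ p q r z)
      ≡⟨ split ⟩
    ∑⁴ A + ∑⁴ B + ∑⁴ C₁ + ∑⁴ C₂ + ∑⁴ C₃
      ≤⟨ +-mono-≤ (+-mono-≤ (+-mono-≤ (+-mono-≤ (≤-reflexive ∑⁴A) ∑⁴B) ∑⁴C₁) ∑⁴C₂) ∑⁴C₃ ⟩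
    n * edgeSum + 2 * edgeSum + nonEdgeSum + nonEdgeSum + nonEdgeSum
      ≡⟨ solve 3 (λ n T M → n :* T :+ con 2 :* T :+ M :+ M :+ M := (n :+ con 2) :* T :+ con 3 :* M) refl
               n edgeSum nonEdgeSum ⟩
    (n + 2) * edgeSum + 3 * nonEdgeSum ∎
    where
    open ≤-Reasoning
    A B C₁ C₂ C₃ : Fin n → Fin n → Fin n → Fin n → ℕ
    A  p q r z = χ p q r
    B  p q r z = 2 * (χ p q r * friendᵢ p q r z)
    C₁ p q r z = χ̄ p q z * friendᵢ p q z r
    C₂ p q r z = χ̄ p r z * friendᵢ p r z q
    C₃ p q r z = χ̄ q r z * friendᵢ q r z p
    split : ∑⁴ (λ p q r z → A p q r z + B p q r z + C₁ p q r z + C₂ p q r z + C₃ p q r z)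
          ≡ ∑⁴ A + ∑⁴ B + ∑⁴ C₁ + ∑⁴ C₂ + ∑⁴ C₃
    split = trans (∑⁴-distrib-+ _ C₃) (cong (_+ ∑⁴ C₃)
           (trans (∑⁴-distrib-+ _ C₂) (cong (_+ ∑⁴ C₂)
           (trans (∑⁴-distrib-+ _ C₁) (cong (_+ ∑⁴ C₁) (∑⁴-distrib-+ A B))))))
    ∑⁴A : ∑⁴ A ≡ n * edgeSum
    ∑⁴A = trans (∑³-cong (λ p q r → sum-const n (χ p q r))) (∑³-*ˡ n χ)
    ∑⁴B : ∑⁴ B ≤ 2 * edgeSum
    ∑⁴B = begin
      ∑⁴ B
        ≡⟨ ∑³-cong (λ p q r → *-distribˡ-sum 2 (λ z → χ p q r * friendᵢ p q r z)) ⟨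
      ∑³ (λ p q r → 2 * sum (λ z → χ p q r * friendᵢ p q r z))
        ≡⟨ ∑³-*ˡ 2 (λ p q r → sum (λ z → χ p q r * friendᵢ p q r z)) ⟩
      2 * ∑⁴ (λ p q r z → χ p q r * friendᵢ p q r z)
        ≤⟨ *-monoʳ-≤ 2 (∑⁴-weighted-friends χ) ⟩
      2 * edgeSum ∎
    ∑⁴C₁ : ∑⁴ C₁ ≤ nonEdgeSum
    ∑⁴C₁ = ≤-trans (≤-reflexive (∑⁴-swap₃₄ C₁)) (∑⁴-weighted-friends χ̄)
    ∑⁴C₂ : ∑⁴ C₂ ≤ nonEdgeSum
    ∑⁴C₂ = ≤-trans (≤-reflexive (trans (∑⁴-swap₂₃ C₂) (∑⁴-swap₃₄ (λ p q r z → C₂ p r q z))))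
                   (∑⁴-weighted-friends χ̄)
    ∑⁴C₃ : ∑⁴ C₃ ≤ nonEdgeSum
    ∑⁴C₃ = ≤-trans (≤-reflexive (trans (∑⁴-swap₁₂ C₃) (trans (∑⁴-swap₂₃ (λ p q r z → C₃ q p r z))
                                                               (∑⁴-swap₃₄ (λ p q r z → C₃ r p q z)))))
                   (∑⁴-weighted-friends χ̄)

  codegreeSquareSum-bound : 3 * codegreeSquareSum ≤ (n + 2) * edgeSum + 3 * nonEdgeSum
  codegreeSquareSum-bound = begin
    3 * codegreeSquareSum ≡⟨ ∑⁴-codegree-side ⟨
    ∑⁴ (λ p q r z → χ p q r * (χ p q z + χ p r z + χ q r z)) ≤⟨ ∑⁴-mono-≤ codegree-pointwise ⟩
    ∑⁴ (λ p q r z → χ p q r + 2 * (χ p q r * friendᵢ p q r z)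
      + χ̄ p q z * friendᵢ p q z r + χ̄ p r z * friendᵢ p r z q + χ̄ q r z * friendᵢ q r z p) ≤⟨ ∑⁴-friend-side ⟩
    (n + 2) * edgeSum + 3 * nonEdgeSum ∎
    where open ≤-Reasoning

module K4Enumeration {n : ℕ} (H : Hypergraph3 n) where

  increasingK4 : Fin n → Fin n → Fin n → Fin n → ℕ
  increasingK4 a b c d = 𝟙 (increasing (a , b , c , d) ∧ k4edge H (a , b , c , d))

  k4? : Decidable (λ (q : Quad n) → k4edge H q ≡ true)
  k4? q = k4edge H q ≟ᵇ true

  inc? : Decidable (λ (q : Quad n) → increasing q ≡ true)
  inc? q = increasing q ≟ᵇ true

  k4count : List (Quad n) → ℕ
  k4count = length ∘ filter k4? ∘ filter inc?

  k4count-++ : ∀ xs ys → k4count (xs ++ ys) ≡ k4count xs + k4count ys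
  k4count-++ xs ys = begin
    length (filter k4? (filter inc? (xs ++ ys)))                  ≡⟨ cong (length ∘ filter k4?) (filter-++ inc? xs ys) ⟩
    length (filter k4? (filter inc? xs ++ filter inc? ys))        ≡⟨ cong length (filter-++ k4? (filter inc? xs) (filter inc? ys)) ⟩
    length (filter k4? (filter inc? xs) ++ filter k4? (filter inc? ys)) ≡⟨ length-++ (filter k4? (filter inc? xs)) ⟩
    k4count xs + k4count ys                                      ∎
    where open ≡-Reasoning

  k4count-singleton : ∀ q → k4count (q ∷ []) ≡ 𝟙 (increasing q ∧ k4edge H q)
  k4count-singleton q = filter-filter-singleton (k4edge H) increasing q

  k4DecompositionSize≡∑⁴ : k4DecompositionSize H ≡ ∑⁴ increasingK4
  k4DecompositionSize≡∑⁴ =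
    trans (countₙ quads₁) (sum-cong-≗ λ a → trans (countₙ (quads₂ a)) (sum-cong-≗ λ b → trans (countₙ (quads₃ a b))
      (sum-cong-≗ λ c → trans (countₙ (quads₄ a b c)) (sum-cong-≗ λ d → k4count-singleton (a , b , c , d)))))
    where
    countₙ : (f : Fin n → List (Quad n)) → k4count (concatMap f (allFin n)) ≡ sum (λ i → k4count (f i))
    countₙ f = count-concatMap k4count refl k4count-++ f (λ i → i)
    quads₄ : Fin n → Fin n → Fin n → Fin n → List (Quad n)
    quads₄ a b c d = (a , b , c , d) ∷ []
    quads₃ : Fin n → Fin n → Fin n → List (Quad n)
    quads₃ a b c = concatMap (quads₄ a b c) (allFin n)
    quads₂ : Fin n → Fin n → List (Quad n)
    quads₂ a b = concatMap (quads₃ a b) (allFin n)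
    quads₁ : Fin n → List (Quad n)
    quads₁ a = concatMap (quads₂ a) (allFin n)

module K4Bound {n : ℕ} (H : Hypergraph3 n) (friendship : IsFriendship H) where

  open HypergraphCounts H
  open K4Enumeration H

  increasingEdgeSum sortedTailEdgeSum : ℕ
  increasingEdgeSum = ∑³ (λ x y z → 𝟙 (x <ᵇ y ∧ y <ᵇ z ∧ edge H x y z))
  sortedTailEdgeSum = ∑³ (λ p q r → 𝟙 (q <ᵇ r) * χ p q r)

  2*sortedTailEdgeSum≤edgeSum : 2 * sortedTailEdgeSum ≤ edgeSum
  2*sortedTailEdgeSum≤edgeSum = begin
    2 * sortedTailEdgeSum
      ≡⟨ cong (sortedTailEdgeSum +_) (+-identityʳ sortedTailEdgeSum) ⟩
    sortedTailEdgeSum + sortedTailEdgeSum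
      ≡⟨ cong (sortedTailEdgeSum +_) (∑³-swap₂₃ (λ p q r → 𝟙 (q <ᵇ r) * χ p q r)) ⟩
    sortedTailEdgeSum + ∑³ (λ p q r → 𝟙 (r <ᵇ q) * χ p r q)
      ≡⟨ ∑³-distrib-+ (λ p q r → 𝟙 (q <ᵇ r) * χ p q r) (λ p q r → 𝟙 (r <ᵇ q) * χ p r q) ⟨
    ∑³ (λ p q r → 𝟙 (q <ᵇ r) * χ p q r + 𝟙 (r <ᵇ q) * χ p r q)
      ≤⟨ ∑³-mono-≤ (λ p q r → subst (λ x → 𝟙 (q <ᵇ r) * χ p q r + 𝟙 (r <ᵇ q) * x ≤ χ p q r) (χ-swap₂₃ p q r)
                                     (exclusive {q <ᵇ r} {r <ᵇ q} (<ᵇ-asym q r) (χ p q r))) ⟩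
    edgeSum ∎
    where
    open ≤-Reasoning
    exclusive : ∀ {a b} → T (not (a ∧ b)) → ∀ x → 𝟙 a * x + 𝟙 b * x ≤ x
    exclusive {true}  {false} _ x = ≤-reflexive (trans (+-identityʳ _) (+-identityʳ x))
    exclusive {false} {true}  _ x = ≤-reflexive (+-identityʳ x)
    exclusive {false} {false} _ x = z≤n

  three-placements : Vec Bool 9 → Bool
  three-placements (lpq ∷ lqp ∷ lqr ∷ lpr ∷ lrp ∷ dpq ∷ dpr ∷ dqr ∷ e ∷ []) =
    (lpq ⇒ᵇ dpq) ⇒ᵇ (lqp ⇒ᵇ dpq) ⇒ᵇ (lqr ⇒ᵇ dqr) ⇒ᵇ (lpr ⇒ᵇ dpr) ⇒ᵇ (lrp ⇒ᵇ dpr) ⇒ᵇ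
    not (lpq ∧ lqp) ⇒ᵇ not (lpr ∧ lrp) ⇒ᵇ
    (lpq ∧ lqr ⇒ᵇ lpr) ⇒ᵇ (lqp ∧ lpr ⇒ᵇ lqr) ⇒ᵇ (lqr ∧ lrp ⇒ᵇ lqp) ⇒ᵇ
    𝟙 (lpq ∧ lqr ∧ e) + 𝟙 (lqp ∧ lpr ∧ e) + 𝟙 (lqr ∧ lrp ∧ e) ≤ᵇ 𝟙 lqr * 𝟙 ((dpq ∧ dpr ∧ dqr) ∧ e)

  three-placements-pointwise : ∀ p q r →
    𝟙 (p <ᵇ q ∧ q <ᵇ r ∧ edge H p q r) + 𝟙 (q <ᵇ p ∧ p <ᵇ r ∧ edge H q p r) + 𝟙 (q <ᵇ r ∧ r <ᵇ p ∧ edge H q r p)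
      ≤ 𝟙 (q <ᵇ r) * χ p q r
  three-placements-pointwise p q r =
    subst₂ (λ e e′ → 𝟙 (p <ᵇ q ∧ q <ᵇ r ∧ edge H p q r) + 𝟙 (q <ᵇ p ∧ p <ᵇ r ∧ e) + 𝟙 (q <ᵇ r ∧ r <ᵇ p ∧ e′)
                       ≤ 𝟙 (q <ᵇ r) * χ p q r)
      (sym₁ H p q r) (trans (sym₁ H p q r) (sym₂ H q p r))
      (≤ᵇ⇒≤ _ _ (valid-sound 9 three-placements tt
        (p <ᵇ q ∷ q <ᵇ p ∷ q <ᵇ r ∷ p <ᵇ r ∷ r <ᵇ p ∷ p ≠ᵇ q ∷ p ≠ᵇ r ∷ q ≠ᵇ r ∷ edge H p q r ∷ [])
        $ᵇ <ᵇ⇒≠ᵇ p q $ᵇ <ᵇ⇒≠ᵇ′ q p $ᵇ <ᵇ⇒≠ᵇ q r $ᵇ <ᵇ⇒≠ᵇ p r $ᵇ <ᵇ⇒≠ᵇ′ r p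
        $ᵇ <ᵇ-asym p q $ᵇ <ᵇ-asym p r
        $ᵇ <ᵇ-trans p q r $ᵇ <ᵇ-trans q p r $ᵇ <ᵇ-trans q r p))
    where
    <ᵇ⇒≠ᵇ′ : ∀ a b → T (a <ᵇ b ⇒ᵇ b ≠ᵇ a)
    <ᵇ⇒≠ᵇ′ a b = subst (λ x → T (a <ᵇ b ⇒ᵇ x)) (≠ᵇ-sym a b) (<ᵇ⇒≠ᵇ a b)

  3*increasingEdgeSum≤sortedTailEdgeSum : 3 * increasingEdgeSum ≤ sortedTailEdgeSum
  3*increasingEdgeSum≤sortedTailEdgeSum = begin
    3 * ∑³ f
      ≡⟨ solve 1 (λ e → con 3 :* e := e :+ e :+ e) refl (∑³ f) ⟩
    ∑³ f + ∑³ f + ∑³ f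
      ≡⟨ cong₂ (λ x y → ∑³ f + x + y) (∑³-swap₁₂ f) (trans (∑³-swap₂₃ f) (∑³-swap₁₂ (λ a b c → f a c b))) ⟩
    ∑³ f + ∑³ (λ p q r → f q p r) + ∑³ (λ p q r → f q r p)
      ≡⟨ trans (∑³-distrib-+ (λ p q r → f p q r + f q p r) (λ p q r → f q r p))
               (cong (_+ ∑³ (λ p q r → f q r p)) (∑³-distrib-+ f (λ p q r → f q p r))) ⟨
    ∑³ (λ p q r → f p q r + f q p r + f q r p)
      ≤⟨ ∑³-mono-≤ three-placements-pointwise ⟩
    sortedTailEdgeSum ∎
    where
    open ≤-Reasoning
    f : Fin n → Fin n → Fin n → ℕ
    f x y z = 𝟙 (x <ᵇ y ∧ y <ᵇ z ∧ edge H x y z)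

  edge-rotate : ∀ {a b c} → IsEdge H a b c → IsEdge H b c a
  edge-rotate {a} {b} {c} e = trans (trans (sym (sym₂ H b a c)) (sym (sym₁ H a b c))) e

  edge-swap₂₃ : ∀ {a b c} → IsEdge H a b c → IsEdge H a c b
  edge-swap₂₃ {a} {b} {c} e = trans (sym (sym₂ H a b c)) e

  increasingK4-pos : ∀ {a b c d} → 1 ≤ increasingK4 a b c d →
    (a < b × b < c × c < d) × (IsEdge H a b c × IsEdge H a b d × IsEdge H a c d × IsEdge H b c d)
  increasingK4-pos {a} {b} {c} {d} h =
    let (ord , edges) = ∧-elim (increasing (a , b , c , d)) (𝟙-pos h)
        (ab , bcd) = ∧-elim (a <ᵇ b) ord
        (bc , cd)  = ∧-elim (b <ᵇ c) bcd
        (abc , rest₁) = ∧-elim (edge H a b c) edges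
        (abd , rest₂) = ∧-elim (edge H a b d) rest₁
        (acd , bcd′)  = ∧-elim (edge H a c d) rest₂
    in (<ᵇ-sound {a = a} ab , <ᵇ-sound {a = b} bc , <ᵇ-sound {a = c} cd)
     , (T-≡ .to abc , T-≡ .to abd , T-≡ .to acd , T-≡ .to bcd′)

  record FriendOfIncreasingEdge (x y z w : Fin n) : Set where
    field
      x<y    : x < y
      y<z    : y < z
      xyz    : IsEdge H x y z
      friend : Friend H x y z w

  insertion : Fin n → Fin n → Fin n → Fin n → ℕ
  insertion x y z w = increasingK4 w x y z + increasingK4 x w y z + increasingK4 x y w z + increasingK4 x y z w

  insertion-pos : ∀ x y z w → 1 ≤ insertion x y z w → FriendOfIncreasingEdge x y z w
  insertion-pos x y z w h with +-pos _ _ h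
  ... | inj₂ h₄ with increasingK4-pos {x} {y} {z} {w} h₄
  ...   | (x<y , y<z , z<w) , (xyz , xyw , xzw , yzw) = record
          { x<y = x<y ; y<z = y<z ; xyz = xyz
          ; friend = ≢-sym (<⇒≢ (<-trans x<y (<-trans y<z z<w))) , ≢-sym (<⇒≢ (<-trans y<z z<w)) , ≢-sym (<⇒≢ z<w)
                   , xyw , xzw , yzw }
  insertion-pos x y z w h | inj₁ h′ with +-pos _ _ h′
  ... | inj₂ h₃ with increasingK4-pos {x} {y} {w} {z} h₃
  ...   | (x<y , y<w , w<z) , (xyw , xyz , xwz , ywz) = record
          { x<y = x<y ; y<z = <-trans y<w w<z ; xyz = xyz
          ; friend = ≢-sym (<⇒≢ (<-trans x<y y<w)) , ≢-sym (<⇒≢ y<w) , <⇒≢ w<z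
                   , xyw , edge-swap₂₃ xwz , edge-swap₂₃ ywz }
  insertion-pos x y z w h | inj₁ h′ | inj₁ h″ with +-pos _ _ h″
  ... | inj₂ h₂ with increasingK4-pos {x} {w} {y} {z} h₂
  ...   | (x<w , w<y , y<z) , (xwy , xwz , xyz , wyz) = record
          { x<y = <-trans x<w w<y ; y<z = y<z ; xyz = xyz
          ; friend = ≢-sym (<⇒≢ x<w) , <⇒≢ w<y , <⇒≢ (<-trans w<y y<z)
                   , edge-swap₂₃ xwy , edge-swap₂₃ xwz , edge-rotate wyz }
  insertion-pos x y z w h | inj₁ h′ | inj₁ h″ | inj₁ h₁ with increasingK4-pos {w} {x} {y} {z} h₁
  ... | (w<x , x<y , y<z) , (wxy , wxz , wyz , xyz) = record
        { x<y = x<y ; y<z = y<z ; xyz = xyz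
        ; friend = <⇒≢ w<x , <⇒≢ (<-trans w<x x<y) , <⇒≢ (<-trans w<x (<-trans x<y y<z))
                 , edge-rotate wxy , edge-rotate wxz , edge-rotate wyz }

  four-insertions : Vec Bool 8 → Bool
  four-insertions (lwx ∷ lxw ∷ lxy ∷ lyz ∷ lwy ∷ lyw ∷ lwz ∷ lzw ∷ []) =
    not (lwx ∧ lxw) ⇒ᵇ not (lwy ∧ lyw) ⇒ᵇ not (lwz ∧ lzw) ⇒ᵇ (lwx ∧ lxy ⇒ᵇ lwy) ⇒ᵇ (lwy ∧ lyz ⇒ᵇ lwz) ⇒ᵇ
    𝟙 (lwx ∧ lxy ∧ lyz) + 𝟙 (lxw ∧ lwy ∧ lyz) + 𝟙 (lxy ∧ lyw ∧ lwz) + 𝟙 (lxy ∧ lyz ∧ lzw) ≤ᵇ 1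

  insertion≤1 : ∀ x y z w → insertion x y z w ≤ 1
  insertion≤1 x y z w = ≤-trans
    (+-mono-≤ (+-mono-≤ (+-mono-≤ (increasingK4≤ w x y z) (increasingK4≤ x w y z)) (increasingK4≤ x y w z))
              (increasingK4≤ x y z w))
    (≤ᵇ⇒≤ _ _ (valid-sound 8 four-insertions tt
        (w <ᵇ x ∷ x <ᵇ w ∷ x <ᵇ y ∷ y <ᵇ z ∷ w <ᵇ y ∷ y <ᵇ w ∷ w <ᵇ z ∷ z <ᵇ w ∷ [])
      $ᵇ <ᵇ-asym w x $ᵇ <ᵇ-asym w y $ᵇ <ᵇ-asym w z $ᵇ <ᵇ-trans w x y $ᵇ <ᵇ-trans w y z))
    where
    increasingK4≤ : ∀ a b c d → increasingK4 a b c d ≤ 𝟙 (a <ᵇ b ∧ b <ᵇ c ∧ c <ᵇ d)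
    increasingK4≤ a b c d = 𝟙-∧-≤ˡ (increasing (a , b , c , d)) (k4edge H (a , b , c , d))

  ∑-insertion : ∀ x y z → sum (insertion x y z) ≤ 𝟙 (x <ᵇ y ∧ y <ᵇ z ∧ edge H x y z)
  ∑-insertion x y z = sum-≤-𝟙 (x <ᵇ y ∧ y <ᵇ z ∧ edge H x y z) (insertion≤1 x y z) unique support
    where
    unique : ∀ u v → 1 ≤ insertion x y z u → 1 ≤ insertion x y z v → u ≡ v
    unique u v hu hv =
      let open FriendOfIncreasingEdge (insertion-pos x y z u hu)
      in proj₂ (friendship x y z (<⇒≢ x<y) (<⇒≢ (<-trans x<y y<z)) (<⇒≢ y<z)) u v
               friend (FriendOfIncreasingEdge.friend (insertion-pos x y z v hv))
    support : ∀ w → 1 ≤ insertion x y z w → T (x <ᵇ y ∧ y <ᵇ z ∧ edge H x y z)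
    support w h =
      let open FriendOfIncreasingEdge (insertion-pos x y z w h)
      in T-∧ .from (<ᵇ-complete x<y , T-∧ .from (<ᵇ-complete y<z , T-≡ .from xyz))

  4*k4Sum≤increasingEdgeSum : 4 * ∑⁴ increasingK4 ≤ increasingEdgeSum
  4*k4Sum≤increasingEdgeSum = begin
    4 * K
      ≡⟨ solve 1 (λ K → con 4 :* K := K :+ K :+ K :+ K) refl K ⟩
    K + K + K + K
      ≡⟨ cong (_+ K) (cong₂ _+_ (cong₂ _+_ first second) third) ⟨
    ∑⁴ i₁ + ∑⁴ i₂ + ∑⁴ i₃ + K
      ≡⟨ trans (∑⁴-distrib-+ (λ x y z w → i₁ x y z w + i₂ x y z w + i₃ x y z w) increasingK4)
          (cong (_+ K) (trans (∑⁴-distrib-+ (λ x y z w → i₁ x y z w + i₂ x y z w) i₃)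
                              (cong (_+ ∑⁴ i₃) (∑⁴-distrib-+ i₁ i₂)))) ⟨
    ∑⁴ insertion
      ≤⟨ ∑³-mono-≤ ∑-insertion ⟩
    increasingEdgeSum ∎
    where
    open ≤-Reasoning
    K : ℕ
    K = ∑⁴ increasingK4
    i₁ i₂ i₃ : Fin n → Fin n → Fin n → Fin n → ℕ
    i₁ x y z w = increasingK4 w x y z
    i₂ x y z w = increasingK4 x w y z
    i₃ x y z w = increasingK4 x y w z
    first : ∑⁴ i₁ ≡ K
    first = trans (∑⁴-swap₃₄ i₁)
                  (trans (∑⁴-swap₂₃ (λ a b c d → increasingK4 c a b d)) (sym (∑⁴-swap₁₂ increasingK4)))
    second : ∑⁴ i₂ ≡ K
    second = trans (∑⁴-swap₃₄ i₂) (sym (∑⁴-swap₂₃ increasingK4))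
    third : ∑⁴ i₃ ≡ K
    third = ∑⁴-swap₃₄ i₃

  24*k4DecompositionSize≤edgeSum : 24 * k4DecompositionSize H ≤ edgeSum
  24*k4DecompositionSize≤edgeSum = begin
    24 * k4DecompositionSize H ≡⟨ cong (24 *_) k4DecompositionSize≡∑⁴ ⟩
    24 * ∑⁴ increasingK4       ≡⟨ solve 1 (λ K → con 24 :* K := con 2 :* (con 3 :* (con 4 :* K))) refl (∑⁴ increasingK4) ⟩
    2 * (3 * (4 * ∑⁴ increasingK4)) ≤⟨ *-monoʳ-≤ 2 (*-monoʳ-≤ 3 4*k4Sum≤increasingEdgeSum) ⟩
    2 * (3 * increasingEdgeSum) ≤⟨ *-monoʳ-≤ 2 3*increasingEdgeSum≤sortedTailEdgeSum ⟩
    2 * sortedTailEdgeSum       ≤⟨ 2*sortedTailEdgeSum≤edgeSum ⟩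
    edgeSum                     ∎
    where open ≤-Reasoning

-- Solving the quadratic inequality

-- At m = 5 + j the right side exceeds the left one by 1 + gap j, a polynomial with nonnegative coefficients.
12ND<δ[X₀+1] : ∀ m → 12 * (suc m * m) * (suc m * (m * (m ∸ 1))) ℕ.< (suc m * m * (m + 3) + 3) * (suc m * suc m * m + 1)
12ND<δ[X₀+1] 0 = ≤ᵇ⇒≤ _ _ tt
12ND<δ[X₀+1] 1 = ≤ᵇ⇒≤ _ _ tt
12ND<δ[X₀+1] 2 = ≤ᵇ⇒≤ _ _ tt
12ND<δ[X₀+1] 3 = ≤ᵇ⇒≤ _ _ tt
12ND<δ[X₀+1] 4 = ≤ᵇ⇒≤ _ _ tt
12ND<δ[X₀+1] (suc (suc (suc (suc (suc j))))) =
  subst (suc (lhs j) ≤_) (expansion j) (m≤m+n (suc (lhs j)) (gap j))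
  where
  lhs gap : ℕ → ℕ
  lhs j = 12 * ((6 + j) * (5 + j)) * ((6 + j) * ((5 + j) * (4 + j)))
  gap j = 782 + 2206 * j + 2290 * (j * j) + 1026 * (j * j * j) + 225 * (j * j * j * j)
          + 24 * (j * j * j * j * j) + j * j * j * j * j * j
  expansion : ∀ j → suc (lhs j) + gap j ≡ ((6 + j) * (5 + j) * ((5 + j) + 3) + 3) * ((6 + j) * (6 + j) * (5 + j) + 1)
  expansion = solve 1 (λ j →
      con 1 :+ con 12 :* ((con 6 :+ j) :* (con 5 :+ j)) :* ((con 6 :+ j) :* ((con 5 :+ j) :* (con 4 :+ j)))
        :+ (con 782 :+ con 2206 :* j :+ con 2290 :* (j :* j) :+ con 1026 :* (j :* j :* j) :+ con 225 :* (j :* j :* j :* j)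
            :+ con 24 :* (j :* j :* j :* j :* j) :+ j :* j :* j :* j :* j :* j)
      := ((con 6 :+ j) :* (con 5 :+ j) :* ((con 5 :+ j) :+ con 3) :+ con 3) :* ((con 6 :+ j) :* (con 6 :+ j) :* (con 5 :+ j) :+ con 1)) refl

edgeSum-quadratic : ∀ m T M S →
  3 * S ≤ (suc m + 2) * T + 3 * M → T * T ≤ suc m * m * S → T + M ≡ suc m * (m * (m ∸ 1)) →
  3 * (T * T) ≤ suc m * m * (m * T + 3 * (suc m * (m * (m ∸ 1))))
edgeSum-quadratic m T M S codegrees cauchy total = begin
  3 * (T * T)                  ≤⟨ *-monoʳ-≤ 3 cauchy ⟩
  3 * (N * S)                  ≡⟨ solve 2 (λ N S → con 3 :* (N :* S) := N :* (con 3 :* S)) refl N S ⟩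
  N * (3 * S)                  ≤⟨ *-monoʳ-≤ N codegrees ⟩
  N * ((suc m + 2) * T + 3 * M) ≡⟨ cong (N *_) (solve 3 (λ m T M → (con 1 :+ m :+ con 2) :* T :+ con 3 :* M
                                                          := m :* T :+ con 3 :* (T :+ M)) refl m T M) ⟩
  N * (m * T + 3 * (T + M))    ≡⟨ cong (λ x → N * (m * T + 3 * x)) total ⟩
  N * (m * T + 3 * (suc m * (m * (m ∸ 1)))) ∎
  where
  open ≤-Reasoning
  N : ℕ
  N = suc m * m

-- In terms of X = 2T, the hypothesis says 3X² ≤ 2NmX + 12ND; the left side wins as soon as X > X₀,
-- because δ, defined by 3(X₀ + 1) = 2Nm + δ, satisfies 12ND < δ(X₀ + 1).
quadratic-bound : ∀ m T → 3 * (T * T) ≤ suc m * m * (m * T + 3 * (suc m * (m * (m ∸ 1)))) →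
  2 * T ≤ suc m * suc m * m
quadratic-bound m T quadratic with 2 * T ≤? suc m * suc m * m
... | yes X≤X₀ = X≤X₀
... | no  X≰X₀ = ⊥-elim (<-irrefl refl (begin-strict
  3 * X * X                     ≡⟨ solve 1 (λ T → con 3 :* (con 2 :* T) :* (con 2 :* T) := con 4 :* (con 3 :* (T :* T))) refl T ⟩
  4 * (3 * (T * T))             ≤⟨ *-monoʳ-≤ 4 quadratic ⟩
  4 * (N * (m * T + 3 * D))     ≡⟨ solve 4 (λ N m T D → con 4 :* (N :* (m :* T :+ con 3 :* D))
                                          := con 2 :* N :* m :* (con 2 :* T) :+ con 12 :* N :* D) refl N m T D ⟩
  2 * N * m * X + 12 * N * D    <⟨ +-monoʳ-< (2 * N * m * X) (12ND<δ[X₀+1] m) ⟩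
  2 * N * m * X + δ * (X₀ + 1)  ≤⟨ +-monoʳ-≤ (2 * N * m * X) (*-monoʳ-≤ δ X₀<X) ⟩
  2 * N * m * X + δ * X         ≡⟨ *-distribʳ-+ X (2 * N * m) δ ⟨
  (2 * N * m + δ) * X           ≡⟨ cong (_* X) (solve 1 (λ m →
                                      con 2 :* ((con 1 :+ m) :* m) :* m :+ ((con 1 :+ m) :* m :* (m :+ con 3) :+ con 3)
                                      := con 3 :* ((con 1 :+ m) :* (con 1 :+ m) :* m :+ con 1)) refl m) ⟩
  3 * (X₀ + 1) * X              ≤⟨ *-monoˡ-≤ X (*-monoʳ-≤ 3 X₀<X) ⟩
  3 * X * X                     ∎))
  where
  open ≤-Reasoning
  N D X X₀ δ : ℕ
  N  = suc m * m
  D  = suc m * (m * (m ∸ 1))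
  X  = 2 * T
  X₀ = suc m * suc m * m
  δ  = suc m * m * (m + 3) + 3
  X₀<X : X₀ + 1 ≤ X
  X₀<X = subst (_≤ X) (+-comm 1 X₀) (≰⇒> X≰X₀)

corollary11 : (n : ℕ) (H : Hypergraph3 n) → IsFriendship H →
    48 * k4DecompositionSize H ≤ n * n * (n ∸ 1)
corollary11 zero    H friendship = z≤n
corollary11 (suc m) H friendship = begin
  48 * k4DecompositionSize H        ≡⟨ *-assoc 2 24 (k4DecompositionSize H) ⟩
  2 * (24 * k4DecompositionSize H)  ≤⟨ *-monoʳ-≤ 2 24*k4DecompositionSize≤edgeSum ⟩
  2 * edgeSum                       ≤⟨ quadratic-bound m edgeSum
                                         (edgeSum-quadratic m edgeSum nonEdgeSum codegreeSquareSum
                                           codegreeSquareSum-bound edgeSum²-bound edgeSum+nonEdgeSum) ⟩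
  suc m * suc m * m                 ∎
  where
  open ≤-Reasoning
  open HypergraphCounts H
  open FriendshipBounds H friendship
  open K4Bound H friendship
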